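{- Let $W_{\Delta,n}$ be a Knödel graph with $\Delta\ge3$ and $n\ge 4(\Delta-3)(2^{\Delta-1}-1)+4$, and let $s=2^{\Delta-1}-1$. Then \[\max_{0\le i\le n/2-1} d(u_0,u_i)=d(u_0,u_{\lfloor n/4\rfloor})=2\left\lceil\frac{1}{s}\left\lfloor\frac n4\right\rfloor\right\rceil.\]
   Context: Knödel graph: for an even integer $n$ and an integer $\Delta$ with $1\le\Delta\le\lfloor\log_2 n\rfloor$, $W_{\Delta,n}$ is the simple bipartite graph with vertex set $U\cup V$, $U=\{u_0,\dots,u_{n/2-1}\}$, $V=\{v_0,\dots,v_{n/2-1}\}$; indices are read modulo $n/2$. The vertices $u_i$ and $v_j$ are adjacent iff $j-i\equiv 2^k-1\pmod{n/2}$ for some $k\in\{0,\dots,\Delta-1\}$; no other edges. $d(x,y)$ is the graph distance. -}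

module Defs where

open import Data.Nat using (ℕ; zero; suc; _+_; _*_; _∸_; _^_; _<_; NonZero)
open import Data.Nat.DivMod using (_mod_; _/_)
open import Data.Fin using (Fin; toℕ)
open import Data.Product using (Σ; _×_)
open import Relation.Binary.PropositionalEquality using (_≡_)

-- Vertices of the Knödel graph W_{Δ,n} with m = n/2:
-- U i = u_i and V j = v_j, for i, j ∈ {0, …, m-1}.
data Vtx (m : ℕ) : Set where
  U : Fin m → Vtx m
  V : Fin m → Vtx m

KAdjUV : (Δ m : ℕ) .{{_ : NonZero m}} → Fin m → Fin m → Set
KAdjUV Δ m i j = Σ ℕ (λ k → (k < Δ) × (j ≡ (toℕ i + (2 ^ k ∸ 1)) mod m))

data Edge (Δ m : ℕ) .{{_ : NonZero m}} : Vtx m → Vtx m → Set where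
  uv : ∀ {i j} → KAdjUV Δ m i j → Edge Δ m (U i) (V j)
  vu : ∀ {i j} → KAdjUV Δ m i j → Edge Δ m (V j) (U i)

data Walk (Δ m : ℕ) .{{_ : NonZero m}} : Vtx m → Vtx m → ℕ → Set where
  here : ∀ {x} → Walk Δ m x x zero
  step : ∀ {x y z k} → Edge Δ m x y → Walk Δ m y z k → Walk Δ m x z (suc k)

IsDist : (Δ m : ℕ) .{{_ : NonZero m}} → Vtx m → Vtx m → ℕ → Set
IsDist Δ m x y d = Walk Δ m x y d × (∀ k → Walk Δ m x y k → d Data.Nat.≤ k)

-- ⌈a / b⌉ for b ≥ 1 (value 0 for b = 0, never used)
ceilDiv : ℕ → ℕ → ℕ
ceilDiv a zero = zero
ceilDiv a (suc b) = (a + b) / suc b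

module Submission where

open import Defs
open import Data.Nat using (ℕ; zero; suc; _+_; _*_; _∸_; _^_; _≤_; _<_; NonZero)
open import Data.Nat.DivMod using (_mod_; _/_)
open import Data.Fin using (Fin)
open import Data.Product using (Σ; _×_)
open import Relation.Binary.PropositionalEquality using (_≡_)

open import Data.Nat using (z≤n; s≤s; s≤s⁻¹; _≤?_; >-nonZero⁻¹)
open import Data.Nat.Properties
open import Data.Nat.DivMod
  using (_%_; m≡m%n+[m/n]*n; m%n<n; m<n⇒m%n≡m; %-distribˡ-+; m%n%n≡m%n; [m+n]%n≡m%n;
         m*n/n≡m; /-monoˡ-≤; m/n*n≤m; m<n*o⇒m/o<n)
open import Data.Nat.Induction using (<-wellFounded)
open import Data.Nat.Tactic.RingSolver using (solve-∀)
open import Data.Fin using (toℕ) renaming (_≟_ to _≟ᶠ_)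
open import Data.Fin.Properties using (toℕ-injective; toℕ-fromℕ<; toℕ<n; any?)
open import Data.Product using (_,_; proj₁; proj₂)
open import Data.Sum using (_⊎_; inj₁; inj₂)
open import Data.Empty using (⊥-elim)
open import Induction.WellFounded using (Acc; acc)
open import Relation.Nullary using (Dec; yes; no)
open import Relation.Unary using (Decidable)
open import Relation.Binary.PropositionalEquality
  using (refl; sym; trans; cong; subst; subst₂; module ≡-Reasoning)

-- A two-step walk u → v → u along the offsets 2^(b+c) − 1 and 2^b − 1 shifts the
-- label by the "block" 2^b·(2^c − 1). Upper bound: if N ≤ t + 1, every number
-- d ≤ t·(2^N − 1) is a sum of t blocks with b + c ≤ N (`representable`, by
-- induction on N); so u₀ reaches u_i in 2t steps when min(i, m − i) ≤ t·(2^N − 1)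
-- (`walkFromOrigin`). Lower bound: along any walk, each step changes the label by at
-- most s, forward and backward steps alternate, and so a walk of length 2a between
-- u-vertices reaches only labels at cyclic distance ≤ a·s (`reach`). Since walks of a
-- fixed length are decidable, the least walk length gives the exact distances
-- (`distanceWithin`).

ones : ℕ → ℕ
ones zero = zero
ones (suc c) = suc (2 * ones c)

2^≡1+ones : ∀ c → 2 ^ c ≡ suc (ones c)
2^≡1+ones zero = refl
2^≡1+ones (suc c) = trans (cong (2 *_) (2^≡1+ones c)) (*-suc 2 (ones c))

2^∸1≡ones : ∀ c → 2 ^ c ∸ 1 ≡ ones c
2^∸1≡ones c = cong (_∸ 1) (2^≡1+ones c)

ones-+ : ∀ b c → ones (b + c) ≡ 2 ^ b * ones c + ones b
ones-+ zero c = sym (trans (+-identityʳ _) (+-identityʳ (ones c)))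
ones-+ (suc b) c = begin
  suc (2 * ones (b + c))             ≡⟨ cong (λ x → suc (2 * x)) (ones-+ b c) ⟩
  suc (2 * (2 ^ b * ones c + ones b)) ≡⟨ shift (2 ^ b) (ones c) (ones b) ⟩
  2 * 2 ^ b * ones c + ones (suc b)  ∎
  where
  open ≡-Reasoning
  shift : ∀ p x y → suc (2 * (p * x + y)) ≡ 2 * p * x + suc (2 * y)
  shift = solve-∀

-- BlockSum N t d: d is a sum of t blocks 2^b·(2^c − 1) with b + c ≤ N
-- (empty blocks allowed), i.e. of t numbers whose binary expansion is one
-- contiguous run of ones inside the lowest N bits.
data BlockSum (N : ℕ) : ℕ → ℕ → Set where
  []    : BlockSum N 0 0
  block : ∀ {t d} b c → b + c ≤ N → BlockSum N t d → BlockSum N (suc t) (2 ^ b * ones c + d)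

emptyBlocks : ∀ N t → BlockSum N t 0
emptyBlocks N zero = []
emptyBlocks N (suc t) = block 0 0 z≤n (emptyBlocks N t)

doubleBlocks : ∀ {N t d} → BlockSum N t d → BlockSum (suc N) t (2 * d)
doubleBlocks [] = []
doubleBlocks (block {d = d} b c b+c≤N r) =
  subst (BlockSum _ _) (shift (2 ^ b) (ones c) d) (block (suc b) c (s≤s b+c≤N) (doubleBlocks r))
  where
  shift : ∀ p x d → 2 * p * x + 2 * d ≡ 2 * (p * x + d)
  shift = solve-∀

fullBlocks : ∀ N u e → BlockSum (suc N) (u + e) (u * ones (suc N) + e * (2 * ones N))
fullBlocks N zero zero = []
fullBlocks N zero (suc e) =
  subst (BlockSum _ _) (shifted (ones N) e) (block 1 N ≤-refl (fullBlocks N zero e))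
  where
  shifted : ∀ x e → 2 * x + (0 + e * (2 * x)) ≡ 0 + suc e * (2 * x)
  shifted = solve-∀
fullBlocks N (suc u) e =
  subst (BlockSum _ _) (full (ones N) u e) (block 0 (suc N) ≤-refl (fullBlocks N u e))
  where
  full : ∀ x u e → 1 * suc (2 * x) + (u * suc (2 * x) + e * (2 * x)) ≡ suc u * suc (2 * x) + e * (2 * x)
  full = solve-∀

highBlocks : ∀ N t d → 2 * (t * ones N) ≤ d → d ≤ t * ones (suc N) → BlockSum (suc N) t d
highBlocks N t d low≤d d≤high = subst₂ (BlockSum _) (m+[n∸m]≡n r≤t) value (fullBlocks N r (t ∸ r))
  where
  open ≡-Reasoning
  X = ones N
  r = d ∸ 2 * (t * X)
  d≡ : 2 * (t * X) + r ≡ d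
  d≡ = m+[n∸m]≡n low≤d
  r≤t : r ≤ t
  r≤t = +-cancelˡ-≤ (2 * (t * X)) r t (subst₂ _≤_ (sym d≡) (top t X) d≤high)
    where top : ∀ t X → t * suc (2 * X) ≡ 2 * (t * X) + t
          top = solve-∀
  value : r * suc (2 * X) + (t ∸ r) * (2 * X) ≡ d
  value = begin
    r * suc (2 * X) + (t ∸ r) * (2 * X) ≡⟨ regroup r (t ∸ r) X ⟩
    2 * ((r + (t ∸ r)) * X) + r         ≡⟨ cong (λ u → 2 * (u * X) + r) (m+[n∸m]≡n r≤t) ⟩
    2 * (t * X) + r                     ≡⟨ d≡ ⟩
    d                                   ∎
    where regroup : ∀ r e X → r * suc (2 * X) + e * (2 * X) ≡ 2 * ((r + e) * X) + r
          regroup = solve-∀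

data Parity : ℕ → Set where
  even : ∀ h → Parity (2 * h)
  odd  : ∀ h → Parity (suc (2 * h))

parity : ∀ d → Parity d
parity zero = even 0
parity (suc d) with parity d
... | even h = odd h
... | odd h = subst Parity (*-suc 2 h) (even (suc h))

oddLarge : ∀ {N t h} → ones N ≤ h → BlockSum N t (h ∸ ones N) → BlockSum (suc N) (suc t) (suc (2 * h))
oddLarge {N} {h = h} X≤h r =
  subst (BlockSum _ _) value (block 0 (suc N) ≤-refl (doubleBlocks r))
  where
  open ≡-Reasoning
  X = ones N
  value : 1 * suc (2 * X) + 2 * (h ∸ X) ≡ suc (2 * h)
  value = begin
    1 * suc (2 * X) + 2 * (h ∸ X) ≡⟨ regroup X (h ∸ X) ⟩
    suc (2 * (X + (h ∸ X)))       ≡⟨ cong (λ y → suc (2 * y)) (m+[n∸m]≡n X≤h) ⟩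
    suc (2 * h)                   ∎
    where regroup : ∀ X e → 1 * suc (2 * X) + 2 * e ≡ suc (2 * (X + e))
          regroup = solve-∀

oddSmall : ∀ {N t h} → BlockSum N t h → BlockSum (suc N) (suc t) (suc (2 * h))
oddSmall r = block 0 1 (s≤s z≤n) (doubleBlocks r)

below-ones : ∀ N t h → N ≤ suc t → h < ones N → h ≤ t * ones N
below-ones N (suc t) h _ h<X = ≤-trans (<⇒≤ h<X) (m≤m+n (ones N) (t * ones N))
below-ones zero zero h _ ()
below-ones (suc zero) zero h _ h<1 = ≤-reflexive (n≤0⇒n≡0 (s≤s⁻¹ h<1))
below-ones (suc (suc _)) zero h (s≤s ()) _

-- Induction on N: large d uses full blocks;
-- otherwise d is halved, an odd lowest bit first becoming the block 1 or a full block.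
representable : ∀ N t d → N ≤ suc t → d ≤ t * ones N → BlockSum N t d
representable zero t d _ d≤ =
  subst (BlockSum 0 t) (sym (n≤0⇒n≡0 (≤-trans d≤ (≤-reflexive (*-zeroʳ t))))) (emptyBlocks 0 t)
representable (suc N) zero d _ d≤0 = subst (BlockSum _ 0) (sym (n≤0⇒n≡0 d≤0)) []
representable (suc N) (suc t) d N≤ d≤ with 2 * (suc t * ones N) ≤? d | parity d
... | yes high | _ = highBlocks N (suc t) d high d≤
... | no low | even h =
  doubleBlocks (representable N (suc t) h (m≤n⇒m≤1+n (s≤s⁻¹ N≤)) (*-cancelˡ-≤ 2 (<⇒≤ (≰⇒> low))))
... | no low | odd h with ones N ≤? h
...   | yes X≤h = oddLarge X≤h (representable N t (h ∸ ones N) (s≤s⁻¹ N≤) (m≤n+o⇒m∸n≤o h (ones N) h≤))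
  where h≤ : h ≤ suc t * ones N
        h≤ = *-cancelˡ-≤ 2 (≤-trans (m≤n+m (2 * h) 2) (≰⇒> low))
...   | no h<X = oddSmall (representable N t h (s≤s⁻¹ N≤) (below-ones N t h (s≤s⁻¹ N≤) (≰⇒> h<X)))

module Residues (m : ℕ) .{{_ : NonZero m}} where

  toℕ-mod : ∀ a → toℕ (a mod m) ≡ a % m
  toℕ-mod a = toℕ-fromℕ< (m%n<n a m)

  mod-cong : ∀ {a b} → a % m ≡ b % m → a mod m ≡ b mod m
  mod-cong {a} {b} e = toℕ-injective (trans (toℕ-mod a) (trans e (sym (toℕ-mod b))))

  toℕ-mod-inverse : (i : Fin m) → toℕ i mod m ≡ i
  toℕ-mod-inverse i = toℕ-injective (trans (toℕ-mod (toℕ i)) (m<n⇒m%n≡m (toℕ<n i)))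

  %-cong-+ : ∀ {a b} c → a % m ≡ b % m → (a + c) % m ≡ (b + c) % m
  %-cong-+ {a} {b} c e = begin
    (a + c) % m             ≡⟨ %-distribˡ-+ a c m ⟩
    (a % m + c % m) % m     ≡⟨ cong (λ r → (r + c % m) % m) e ⟩
    (b % m + c % m) % m     ≡⟨ sym (%-distribˡ-+ b c m) ⟩
    (b + c) % m             ∎
    where open ≡-Reasoning

  toℕ-mod-+ : ∀ a b → (toℕ (a mod m) + b) % m ≡ (a + b) % m
  toℕ-mod-+ a b = %-cong-+ b (trans (cong (_% m) (toℕ-mod a)) (m%n%n≡m%n a m))

  residue-gap : ∀ {a b} → a % m ≡ b % m → a < b → a + m ≤ b
  residue-gap {a} {b} e a<b with b / m ≤? a / m
  ... | yes b/m≤a/m = ⊥-elim (<⇒≱ a<b (begin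
    b                 ≡⟨ m≡m%n+[m/n]*n b m ⟩
    b % m + b / m * m ≡⟨ cong (_+ b / m * m) (sym e) ⟩
    a % m + b / m * m ≤⟨ +-monoʳ-≤ (a % m) (*-monoˡ-≤ m b/m≤a/m) ⟩
    a % m + a / m * m ≡⟨ sym (m≡m%n+[m/n]*n a m) ⟩
    a                 ∎))
    where open ≤-Reasoning
  ... | no b/m≰a/m = begin
    a + m                     ≡⟨ cong (_+ m) (m≡m%n+[m/n]*n a m) ⟩
    a % m + a / m * m + m     ≡⟨ +-assoc (a % m) (a / m * m) m ⟩
    a % m + (a / m * m + m)   ≡⟨ cong (a % m +_) (+-comm (a / m * m) m) ⟩
    a % m + suc (a / m) * m   ≤⟨ +-monoʳ-≤ (a % m) (*-monoˡ-≤ m (≰⇒> b/m≰a/m)) ⟩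
    a % m + b / m * m         ≡⟨ cong (_+ b / m * m) e ⟩
    b % m + b / m * m         ≡⟨ sym (m≡m%n+[m/n]*n b m) ⟩
    b                         ∎
    where open ≤-Reasoning

  -- If j + L ≡ G (mod m) and 2j ≤ m then j ≤ G or j ≤ L: a displacement of
  -- +G followed by −L can only reach the label j by passing it in one direction.
  cyclic-cover : ∀ {j G L} → (j + L) % m ≡ G % m → 2 * j ≤ m → j ≤ G ⊎ j ≤ L
  cyclic-cover {j} {G} {L} e 2j≤m with j + L ≤? G
  ... | yes j+L≤G = inj₁ (≤-trans (m≤m+n j L) j+L≤G)
  ... | no j+L≰G = inj₂ (+-cancelˡ-≤ j j L (begin
    j + j     ≡⟨ cong (j +_) (sym (+-identityʳ j)) ⟩
    2 * j     ≤⟨ 2j≤m ⟩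
    m         ≤⟨ m≤n+m m G ⟩
    G + m     ≤⟨ residue-gap (sym e) (≰⇒> j+L≰G) ⟩
    j + L     ∎))
    where open ≤-Reasoning

module Walks (Δ m : ℕ) .{{_ : NonZero m}} where
  open Residues m

  _++_ : ∀ {x y z k l} → Walk Δ m x y k → Walk Δ m y z l → Walk Δ m x z (k + l)
  here ++ w = w
  step e v ++ w = step e (v ++ w)

  flipEdge : ∀ {x y} → Edge Δ m x y → Edge Δ m y x
  flipEdge (uv p) = vu p
  flipEdge (vu p) = uv p

  reverse : ∀ {x y k} → Walk Δ m x y k → Walk Δ m y x k
  reverse here = here
  reverse {k = suc k} (step e w) = subst (Walk Δ m _ _) (+-comm k 1) (reverse w ++ step (flipEdge e) here)

  -- Going u → v along offset 2^(b+c) − 1 and back along offset 2^b − 1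
  -- moves the label by the block 2^b·(2^c − 1).
  blockWalk : ∀ b c → b + c < Δ → (a : ℕ) → Walk Δ m (U (a mod m)) (U ((a + 2 ^ b * ones c) mod m)) 2
  blockWalk b c b+c<Δ a =
    step (uv (b + c , b+c<Δ , refl)) (step (vu (b , ≤-<-trans (m≤m+n b c) b+c<Δ , mod-cong back)) here)
    where
    open ≡-Reasoning
    v = 2 ^ b * ones c
    back : (toℕ (a mod m) + (2 ^ (b + c) ∸ 1)) % m ≡ (toℕ ((a + v) mod m) + (2 ^ b ∸ 1)) % m
    back = begin
      (toℕ (a mod m) + (2 ^ (b + c) ∸ 1)) % m ≡⟨ toℕ-mod-+ a _ ⟩
      (a + (2 ^ (b + c) ∸ 1)) % m             ≡⟨ cong (λ o → (a + o) % m) (trans (2^∸1≡ones (b + c)) (ones-+ b c)) ⟩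
      (a + (v + ones b)) % m                  ≡⟨ cong (_% m) (sym (+-assoc a v (ones b))) ⟩
      (a + v + ones b) % m                    ≡⟨ cong (λ o → (a + v + o) % m) (sym (2^∸1≡ones b)) ⟩
      (a + v + (2 ^ b ∸ 1)) % m               ≡⟨ sym (toℕ-mod-+ (a + v) _) ⟩
      (toℕ ((a + v) mod m) + (2 ^ b ∸ 1)) % m ∎

  blockSumWalk : ∀ {N t d} → N < Δ → BlockSum N t d → (a : ℕ) → Walk Δ m (U (a mod m)) (U ((a + d) mod m)) (2 * t)
  blockSumWalk _ [] a = subst (λ y → Walk Δ m (U (a mod m)) (U (y mod m)) 0) (sym (+-identityʳ a)) here
  blockSumWalk N<Δ (block {t} {d} b c b+c≤N r) a =
    subst₂ (λ y k → Walk Δ m (U (a mod m)) (U (y mod m)) k) (+-assoc a v d) (sym (*-suc 2 t))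
      (blockWalk b c (≤-<-trans b+c≤N N<Δ) a ++ blockSumWalk N<Δ r (a + v))
    where v = 2 ^ b * ones c

  -- u₀ reaches u_i in 2t steps when N < Δ, N ≤ t + 1 and min(i, m − i) ≤ t·(2^N − 1):
  -- walk forward to i, or walk from u_i forward to u_m = u₀ and reverse.
  walkFromOrigin : ∀ {N} t → N < Δ → N ≤ suc t → (i : Fin m)
    → toℕ i ≤ t * ones N ⊎ m ∸ toℕ i ≤ t * ones N → Walk Δ m (U (0 mod m)) (U i) (2 * t)
  walkFromOrigin {N} t N<Δ N≤ i (inj₁ i≤) =
    subst (λ y → Walk Δ m (U (0 mod m)) (U y) _) (toℕ-mod-inverse i)
      (blockSumWalk N<Δ (representable N t (toℕ i) N≤ i≤) 0)
  walkFromOrigin {N} t N<Δ N≤ i (inj₂ m-i≤) =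
    reverse (subst₂ (λ x y → Walk Δ m (U x) (U y) _) (toℕ-mod-inverse i) around
      (blockSumWalk N<Δ (representable N t (m ∸ toℕ i) N≤ m-i≤) (toℕ i)))
    where
    around : (toℕ i + (m ∸ toℕ i)) mod m ≡ 0 mod m
    around = mod-cong (trans (cong (_% m) (m+[n∸m]≡n (<⇒≤ (toℕ<n i)))) ([m+n]%n≡m%n 0 m))

least : ∀ {p} {P : ℕ → Set p} → Decidable P → ∀ K → P K
  → Σ ℕ λ k → P k × (∀ k′ → P k′ → k ≤ k′) × k ≤ K
least {P = P} P? K pK = go K (<-wellFounded K) pK
  where
  go : ∀ K → Acc _<_ K → P K → Σ ℕ λ k → P k × (∀ k′ → P k′ → k ≤ k′) × k ≤ K
  go K (acc smaller) pK with anyUpTo? P? K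
  ... | no none = K , pK , (λ k′ pk′ → ≮⇒≥ (λ k′<K → none (k′ , k′<K , pk′))) , ≤-refl
  ... | yes (n , n<K , pn) with go n (smaller n<K) pn
  ...   | k , pk , minimal , k≤n = k , pk , minimal , ≤-trans k≤n (<⇒≤ n<K)

-- The graph is finite, so the existence of a walk of given length is decidable;
-- hence any walk of length K yields the exact distance, which is at most K.
module Distances (Δ m : ℕ) .{{_ : NonZero m}} where

  adjacent? : ∀ i j → Dec (KAdjUV Δ m i j)
  adjacent? i j = anyUpTo? (λ k → j ≟ᶠ ((toℕ i + (2 ^ k ∸ 1)) mod m)) Δ

  edge? : ∀ x y → Dec (Edge Δ m x y)
  edge? (U i) (U j) = no λ ()
  edge? (V j) (V i) = no λ ()
  edge? (U i) (V j) with adjacent? i j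
  ... | yes p = yes (uv p)
  ... | no ¬p = no λ { (uv p) → ¬p p }
  edge? (V j) (U i) with adjacent? i j
  ... | yes p = yes (vu p)
  ... | no ¬p = no λ { (vu p) → ¬p p }

  vertex? : (x y : Vtx m) → Dec (x ≡ y)
  vertex? (U i) (V j) = no λ ()
  vertex? (V j) (U i) = no λ ()
  vertex? (U i) (U j) with i ≟ᶠ j
  ... | yes refl = yes refl
  ... | no i≢j = no λ { refl → i≢j refl }
  vertex? (V i) (V j) with i ≟ᶠ j
  ... | yes refl = yes refl
  ... | no i≢j = no λ { refl → i≢j refl }

  walk? : ∀ k x y → Dec (Walk Δ m x y k)
  walk? zero x y with vertex? x y
  ... | yes refl = yes here
  ... | no x≢y = no λ { here → x≢y refl }
  walk? (suc k) x y with any? (λ i → via? (U i)) | any? (λ i → via? (V i))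
    where
    via? : ∀ z → Dec (Edge Δ m x z × Walk Δ m z y k)
    via? z with edge? x z | walk? k z y
    ... | yes e | yes w = yes (e , w)
    ... | no ¬e | _ = no λ p → ¬e (proj₁ p)
    ... | _ | no ¬w = no λ p → ¬w (proj₂ p)
  ... | yes (_ , e , w) | _ = yes (step e w)
  ... | no _ | yes (_ , e , w) = yes (step e w)
  ... | no ¬viaU | no ¬viaV =
    no λ { (step {y = U i} e w) → ¬viaU (i , e , w) ; (step {y = V j} e w) → ¬viaV (j , e , w) }

  distanceWithin : ∀ {x y K} → Walk Δ m x y K → Σ ℕ λ d → IsDist Δ m x y d × d ≤ K
  distanceWithin {x} {y} {K} w with least (λ k → walk? k x y) K w
  ... | d , wd , minimal , d≤K = d , (wd , minimal) , d≤K

module Displacements (Δ m : ℕ) .{{_ : NonZero m}} (s : ℕ) (offset≤ : ∀ k → k < Δ → 2 ^ k ∸ 1 ≤ s) where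
  open Residues m
  open ≡-Reasoning

  label : Vtx m → ℕ
  label (U i) = toℕ i
  label (V j) = toℕ j

  side : Vtx m → ℕ
  side (U _) = 0
  side (V _) = 1

  -- Bookkeeping for a walk from x to y of length k: its forward (u → v) steps add
  -- gain to the label and its backward (v → u) steps subtract loss.
  record Displacement (x y : Vtx m) (k : ℕ) : Set where
    field
      forward backward gain loss : ℕ
      residue  : (label y + loss) % m ≡ (label x + gain) % m
      gain≤    : gain ≤ forward * s
      loss≤    : loss ≤ backward * s
      length   : forward + backward ≡ k
      balanced : forward + side x ≡ backward + side y

  stay : ∀ {x} → Displacement x x 0
  stay = record { forward = 0 ; backward = 0 ; gain = 0 ; loss = 0 ; residue = refl
                ; gain≤ = z≤n ; loss≤ = z≤n ; length = refl ; balanced = refl }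

  forwardStep : ∀ {i j y k} → KAdjUV Δ m i j → Displacement (V j) y k → Displacement (U i) y (suc k)
  forwardStep {i} {j} {y} (a , a<Δ , j≡) D = record
    { forward = suc forward ; backward = backward ; gain = o + gain ; loss = loss
    ; residue = begin
        (label y + loss) % m                      ≡⟨ residue ⟩
        (toℕ j + gain) % m                        ≡⟨ cong (λ j′ → (toℕ j′ + gain) % m) j≡ ⟩
        (toℕ ((toℕ i + o) mod m) + gain) % m      ≡⟨ toℕ-mod-+ (toℕ i + o) gain ⟩
        (toℕ i + o + gain) % m                    ≡⟨ cong (_% m) (+-assoc (toℕ i) o gain) ⟩
        (toℕ i + (o + gain)) % m                  ∎
    ; gain≤ = +-mono-≤ (offset≤ a a<Δ) gain≤
    ; loss≤ = loss≤
    ; length = cong suc length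
    ; balanced = trans (trans (+-identityʳ (suc forward)) (+-comm 1 forward)) balanced
    }
    where
    open Displacement D
    o = 2 ^ a ∸ 1

  backwardStep : ∀ {i j y k} → KAdjUV Δ m i j → Displacement (U i) y k → Displacement (V j) y (suc k)
  backwardStep {i} {j} {y} (a , a<Δ , j≡) D = record
    { forward = forward ; backward = suc backward ; gain = gain ; loss = loss + o
    ; residue = begin
        (label y + (loss + o)) % m                ≡⟨ cong (_% m) (sym (+-assoc (label y) loss o)) ⟩
        (label y + loss + o) % m                  ≡⟨ %-cong-+ o residue ⟩
        (toℕ i + gain + o) % m                    ≡⟨ cong (_% m) (+-assoc (toℕ i) gain o) ⟩
        (toℕ i + (gain + o)) % m                  ≡⟨ cong (λ g → (toℕ i + g) % m) (+-comm gain o) ⟩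
        (toℕ i + (o + gain)) % m                  ≡⟨ cong (_% m) (sym (+-assoc (toℕ i) o gain)) ⟩
        (toℕ i + o + gain) % m                    ≡⟨ sym (toℕ-mod-+ (toℕ i + o) gain) ⟩
        (toℕ ((toℕ i + o) mod m) + gain) % m      ≡⟨ cong (λ j′ → (toℕ j′ + gain) % m) (sym j≡) ⟩
        (toℕ j + gain) % m                        ∎
    ; gain≤ = gain≤
    ; loss≤ = subst (loss + o ≤_) (+-comm (backward * s) s) (+-mono-≤ loss≤ (offset≤ a a<Δ))
    ; length = trans (+-suc forward backward) (cong suc length)
    ; balanced = trans (+-comm forward 1) (cong suc (trans (sym (+-identityʳ forward)) balanced))
    }
    where
    open Displacement D
    o = 2 ^ a ∸ 1

  displacement : ∀ {x y k} → Walk Δ m x y k → Displacement x y k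
  displacement here = stay
  displacement (step (uv p) w) = forwardStep p (displacement w)
  displacement (step (vu p) w) = backwardStep p (displacement w)

  reach : ∀ {k} (z y : Fin m) → toℕ z ≡ 0 → 2 * toℕ y ≤ m → Walk Δ m (U z) (U y) k
    → Σ ℕ λ a → k ≡ a + a × toℕ y ≤ a * s
  reach {k} z y z≡0 2y≤m w = forward , sym evenLength , covered (cyclic-cover residue′ 2y≤m)
    where
    open Displacement (displacement w)
    forward≡backward : forward ≡ backward
    forward≡backward = trans (sym (+-identityʳ forward)) (trans balanced (+-identityʳ backward))
    evenLength : forward + forward ≡ k
    evenLength = trans (cong (forward +_) forward≡backward) length
    residue′ : (toℕ y + loss) % m ≡ gain % m
    residue′ = trans residue (cong (λ x → (x + gain) % m) z≡0)
    covered : toℕ y ≤ gain ⊎ toℕ y ≤ loss → toℕ y ≤ forward * s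
    covered (inj₁ y≤gain) = ≤-trans y≤gain gain≤
    covered (inj₂ y≤loss) = ≤-trans y≤loss (subst (λ b → loss ≤ b * s) (sym forward≡backward) loss≤)

ceilDiv-spec : ∀ j s → j ≤ ceilDiv j (suc s) * suc s
ceilDiv-spec j s = +-cancelʳ-≤ s j _ (begin
  j + s                       ≡⟨ m≡m%n+[m/n]*n (j + s) (suc s) ⟩
  (j + s) % suc s + q * suc s ≤⟨ +-monoˡ-≤ (q * suc s) (s≤s⁻¹ (m%n<n (j + s) (suc s))) ⟩
  s + q * suc s               ≡⟨ +-comm s _ ⟩
  q * suc s + s               ∎)
  where
  open ≤-Reasoning
  q = ceilDiv j (suc s)

ceilDiv-least : ∀ j t s → j ≤ t * suc s → ceilDiv j (suc s) ≤ t
ceilDiv-least j t s j≤ = s≤s⁻¹ (m<n*o⇒m/o<n (begin-strict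
  j + s           <⟨ s≤s (≤-reflexive (+-comm j s)) ⟩
  suc s + j       ≤⟨ +-monoʳ-≤ (suc s) j≤ ⟩
  suc s + t * suc s ∎))
  where open ≤-Reasoning

module Eccentricity (δ m : ℕ) .{{_ : NonZero m}} (hyp : 4 * δ * ones (suc (suc δ)) + 4 ≤ 2 * m) where
  open Residues m
  open Walks (suc (suc (suc δ))) m
  open Distances (suc (suc (suc δ))) m

  N = suc (suc δ)
  Δ = suc N
  S = ones N
  j = (2 * m) / 4
  T = ceilDiv j S

  offset≤S : ∀ k → k < Δ → 2 ^ k ∸ 1 ≤ S
  offset≤S k k<Δ = ≤-trans (∸-monoˡ-≤ 1 (^-monoʳ-≤ 2 (s≤s⁻¹ k<Δ))) (≤-reflexive (2^∸1≡ones N))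

  open Displacements Δ m S offset≤S

  j≤TS : j ≤ T * S
  j≤TS = ceilDiv-spec j (2 * ones (suc δ))

  δS<j : δ * S + 1 ≤ j
  δS<j = begin
    δ * S + 1           ≡⟨ sym (m*n/n≡m (δ * S + 1) 4) ⟩
    (δ * S + 1) * 4 / 4 ≤⟨ /-monoˡ-≤ 4 (≤-trans (≤-reflexive (expand δ S)) hyp) ⟩
    j                   ∎
    where
    open ≤-Reasoning
    expand : ∀ d s → (d * s + 1) * 4 ≡ 4 * d * s + 4
    expand = solve-∀

  -- so T ≥ δ + 1, i.e. Δ − 1 ≤ T + 1 as needed for block sums
  N≤1+T : N ≤ suc T
  N≤1+T = s≤s (*-cancelʳ-< S δ T (≤-trans (≤-reflexive (+-comm 1 (δ * S))) (≤-trans δS<j j≤TS)))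

  2j≤m : 2 * j ≤ m
  2j≤m = *-cancelˡ-≤ 2 (≤-trans (≤-reflexive (regroup j)) (m/n*n≤m (2 * m) 4))
    where regroup : ∀ j → 2 * (2 * j) ≡ j * 4
          regroup = solve-∀

  m≤2j+1 : m ≤ suc (2 * j)
  m≤2j+1 = s≤s⁻¹ (*-cancelˡ-< 2 m (suc (suc (2 * j))) (begin-strict
    2 * m                 ≡⟨ m≡m%n+[m/n]*n (2 * m) 4 ⟩
    (2 * m) % 4 + j * 4   <⟨ +-monoˡ-< (j * 4) (m%n<n (2 * m) 4) ⟩
    4 + j * 4             ≡⟨ regroup j ⟩
    2 * suc (suc (2 * j)) ∎))
    where
    open ≤-Reasoning
    regroup : ∀ j → 4 + j * 4 ≡ 2 * suc (suc (2 * j))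
    regroup = solve-∀

  toℕ-j : toℕ (j mod m) ≡ j
  toℕ-j = trans (toℕ-mod j) (m<n⇒m%n≡m j<m)
    where
    j<m : j < m
    j<m = begin-strict
      j       <⟨ ≤-reflexive (+-comm 1 j) ⟩
      j + 1   ≤⟨ +-monoʳ-≤ j (≤-trans (m≤n+m 1 (δ * S)) δS<j) ⟩
      j + j   ≡⟨ cong (j +_) (sym (+-identityʳ j)) ⟩
      2 * j   ≤⟨ 2j≤m ⟩
      m       ∎
      where open ≤-Reasoning

  toℕ-0 : toℕ (0 mod m) ≡ 0
  toℕ-0 = trans (toℕ-mod 0) (m<n⇒m%n≡m (>-nonZero⁻¹ m))

  nearOrigin : (i : Fin m) → toℕ i ≤ T * S ⊎ m ∸ toℕ i ≤ T * S
  nearOrigin i with toℕ i ≤? j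
  ... | yes i≤j = inj₁ (≤-trans i≤j j≤TS)
  ... | no i≰j = inj₂ (≤-trans (m≤n+o⇒m∸n≤o m (toℕ i) m≤i+j) j≤TS)
    where
    m≤i+j : m ≤ toℕ i + j
    m≤i+j = begin
      m               ≤⟨ m≤2j+1 ⟩
      suc (2 * j)     ≡⟨ cong (λ x → suc (j + x)) (+-identityʳ j) ⟩
      suc j + j       ≤⟨ +-monoˡ-≤ j (≰⇒> i≰j) ⟩
      toℕ i + j       ∎
      where open ≤-Reasoning

  walkTo : (i : Fin m) → Walk Δ m (U (0 mod m)) (U i) (2 * T)
  walkTo i = walkFromOrigin T ≤-refl N≤1+T i (nearOrigin i)

  noShortcut : ∀ k → Walk Δ m (U (0 mod m)) (U (j mod m)) k → 2 * T ≤ k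
  noShortcut k w with reach (0 mod m) (j mod m) toℕ-0 (subst (λ x → 2 * x ≤ m) (sym toℕ-j) 2j≤m) w
  ... | a , k≡a+a , j≤aS = begin
    2 * T   ≡⟨ cong (T +_) (+-identityʳ T) ⟩
    T + T   ≤⟨ +-mono-≤ T≤a T≤a ⟩
    a + a   ≡⟨ sym k≡a+a ⟩
    k       ∎
    where
    open ≤-Reasoning
    T≤a : T ≤ a
    T≤a = ceilDiv-least j a (2 * ones (suc δ)) (subst (_≤ a * S) toℕ-j j≤aS)

  eccentricity : (i : Fin m) → Σ ℕ λ k → IsDist Δ m (U (0 mod m)) (U i) k × k ≤ 2 * T
  eccentricity i = distanceWithin (walkTo i)

  antipodeDistance : IsDist Δ m (U (0 mod m)) (U (j mod m)) (2 * T)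
  antipodeDistance = walkTo (j mod m) , noShortcut

mainTheorem11 : (Δ n m : ℕ) .{{_ : NonZero m}} → n ≡ 2 * m → 1 ≤ Δ → 2 ^ Δ ≤ n → 3 ≤ Δ
    → 4 * (Δ ∸ 3) * (2 ^ (Δ ∸ 1) ∸ 1) + 4 ≤ n
    → ((i : Fin m) → Σ ℕ (λ k → IsDist Δ m (U (0 mod m)) (U i) k × (k ≤ 2 * ceilDiv (n / 4) (2 ^ (Δ ∸ 1) ∸ 1))))
      × IsDist Δ m (U (0 mod m)) (U ((n / 4) mod m)) (2 * ceilDiv (n / 4) (2 ^ (Δ ∸ 1) ∸ 1))
mainTheorem11 (suc (suc (suc δ))) n m refl _ _ _ hyp rewrite 2^∸1≡ones (suc (suc δ)) =
  eccentricity , antipodeDistance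
  where open Eccentricity δ m hyp
mainTheorem11 zero n m _ () _ _ _
mainTheorem11 (suc zero) n m _ _ _ (s≤s ()) _
mainTheorem11 (suc (suc zero)) n m _ _ _ (s≤s (s≤s ())) _
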